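{- (Progress.) Let $s$ be a term of $\mathsf{CAP}$ and $A$ a $\mu$-type such that $\vdash s : A$ is derivable in the empty typing context. If $s$ is not a value, then there exists $s'$ with $s \to s'$.
   Context: Values: $v ::= x\,v_1\cdots v_n \mid \mathsf{c}\,v_1\cdots v_n \mid (p_1\to_{\theta_1}s_1\mid\dots\mid p_n\to_{\theta_n}s_n)$ ($n\ge 0$ in the first two forms). Types. Fix countably infinite pairwise disjoint sets of datatype variables $\alpha,\beta,\dots$, type variables $X,Y,\dots$ and type constants $\mathsf{c},\mathsf{d},\dots$; $V,W$ range over variables of either kind and $a$ over variables and constants. $\mu$-datatypes: $D ::= \alpha \mid \mathsf{c} \mid D @ A \mid D \oplus D \mid \mu\alpha.D$; $\mu$-types: $A ::= X \mid D \mid A \supset A \mid A \oplus A \mid \mu X.A$. $\mu V.A$ is contractive if $V$ occurs in $A$ only under $\supset$ or $@$ (if at all); all $\mu$-types considered are contractive. $\bigoplus_{i\in 1..n} A_i$ denotes an iterated union in any association. Type equivalence $\simeq_\mu$ is the least relation closed under reflexivity, symmetry, transitivity, congruence for $\supset$, $@$, $\oplus$ and $\mu V$, and the axioms $A\oplus A\simeq_\mu A$, $A\oplus B\simeq_\mu B\oplus A$, $A\oplus(B\oplus C)\simeq_\mu (A\oplus B)\oplus C$, $\mu V.A\simeq_\mu A\{V:=\mu V.A\}$, and: if $A\simeq_\mu B\{V:=A\}$ and $\mu V.B$ is contractive then $A\simeq_\mu \mu V.B$. Subtyping judgements $\Sigma\vdash A\preceq_\mu B$ ($\Sigma$ a set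 of assumptions $V\preceq_\mu W$) are derived by: reflexivity; $\Sigma,V\preceq_\mu W\vdash V\preceq_\mu W$; if $A\simeq_\mu B$ then $A\preceq_\mu B$; transitivity; from $D\preceq_\mu D'$, $A\preceq_\mu A'$ infer $D@A\preceq_\mu D'@A'$; from $A\preceq_\mu A'$, $B\preceq_\mu B'$ infer $A'\supset B\preceq_\mu A\supset B'$; from $A\preceq_\mu C$, $B\preceq_\mu C$ infer $A\oplus B\preceq_\mu C$; from $A\preceq_\mu B$ infer $A\preceq_\mu B\oplus C$ and $A\preceq_\mu C\oplus B$; from $\Sigma,V\preceq_\mu W\vdash A\preceq_\mu B$ with $W\notin fv(A)$, $V\notin fv(B)$ infer $\Sigma\vdash \mu V.A\preceq_\mu\mu W.B$. $A\preceq_\mu B$ means derivability with empty $\Sigma$. Calculus $\mathsf{CAP}$. Patterns $p ::= x \mid \mathsf{c} \mid p\,p$ (linear; $fm(p)$ its variables). Terms $t ::= x \mid \mathsf{c} \mid t\,t \mid (p_1\to_{\theta_1} t_1 \mid \dots \mid p_n\to_{\theta_n} t_n)$ ($\theta_i$ typing contexts; $fm(p_i)$ bound in $t_i$). Data structures $d ::= \mathsf{c}\mid d\,t$; matchable forms are data structures and abstractions. Matching $\{\!\{p/u\}\!\}$, clauses tried top to bottom: $\{\!\{x/u\}\!\}=\{x:=u\}$; $\{\!\{\mathsf{c}/\mathsf{c}\}\!\}=\{\}$; $\{\!\{p\,q/u\,v\}\!\}=\{\!\{p/u\}\!\}\uplus\{\!\{q/v\}\!\}$ if $u\,v$ is a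 matchable form; $\{\!\{p/u\}\!\}=\mathtt{fail}$ if $u$ is a matchable form; otherwise $\mathtt{wait}$; where $\mathtt{fail}$ absorbs everything, $\sigma_1\uplus\sigma_2$ is union of substitutions, and any other combination with $\mathtt{wait}$ gives $\mathtt{wait}$. Reduction $\to$ is the closure under all contexts of: $(p_i\to_{\theta_i}s_i)_{i\in1..n}\,u \to \sigma_j s_j$ if $\{\!\{p_i/u\}\!\}=\mathtt{fail}$ for all $i<j$ and $\{\!\{p_j/u\}\!\}=\sigma_j$. Typing. Patterns: $\theta\vdash_p x:\theta(x)$; $\theta\vdash_p\mathsf{c}:\mathsf{c}$; from $\theta\vdash_p p:D$, $\theta\vdash_p q:A$ infer $\theta\vdash_p p\,q:D@A$. Terms: $\Gamma\vdash x:\Gamma(x)$; $\Gamma\vdash\mathsf{c}:\mathsf{c}$; from $\Gamma\vdash r:D$, $\Gamma\vdash u:A$ infer $\Gamma\vdash r\,u:D@A$; from: $[\theta_i\vdash p_i:A_i]_{i\in1..n}$ compatible, $\theta_i\vdash_p p_i:A_i$, $dom(\theta_i)=fm(p_i)$, $\Gamma,\theta_i\vdash s_i:B$ for all $i$, infer $\Gamma\vdash(p_i\to_{\theta_i}s_i)_{i\in1..n}:(\bigoplus_{i}A_i)\supset B$; from $\Gamma\vdash r:(\bigoplus_{i\in1..n}A_i)\supset B$ and $\Gamma\vdash u:A_k$, $k\in1..n$, infer $\Gamma\vdash r\,u:B$; from $\Gamma\vdash s:A$ and $A\preceq_\mu A'$ infer $\Gamma\vdash s:A'$. Compatibility. $p$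 subsumes $q$ if $\sigma p=q$ for some $\sigma$. $mm(p,q)$ is the set of maximal (w.r.t. prefix extension) positions $\pi$ of $pos(p)\cap pos(q)$ with $p|_\pi$ not subsuming $q|_\pi$. Symbols admitted at $\pi$: $a\|\epsilon=\{a\}$; $(A_1\star A_2)\|\epsilon=\{\star\}$, $(A_1\star A_2)\|i\pi=A_i\|\pi$ for $\star\in\{\supset,@\}$; $(A_1\oplus A_2)\|\pi=A_1\|\pi\cup A_2\|\pi$; $(\mu V.A)\|\pi=(A\{V:=\mu V.A\})\|\pi$. $(\theta\vdash p:A)$ is compatible with $(\theta'\vdash q:B)$ iff (1) if $p$ subsumes $q$ then $B\preceq_\mu A$, and (2) if $p$ does not subsume $q$ and $A\|\pi\cap B\|\pi\neq\varnothing$ for all $\pi\in mm(p,q)$, then $B\preceq_\mu A$. A list is compatible if each element is compatible with every later one. -}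

module Defs where

open import Data.Nat using (ℕ; zero; suc; _≡ᵇ_)
open import Data.Bool using (Bool; true; false; if_then_else_; _∨_)
open import Data.List using (List; []; _∷_; _++_; map; zip)
open import Data.List.Membership.Propositional using (_∈_; _∉_)
open import Data.List.Relation.Unary.Unique.Propositional using (Unique)
open import Data.List.Relation.Unary.AllPairs using (AllPairs)
open import Data.Maybe using (Maybe; just; nothing)
open import Data.Product using (Σ; ∃; _×_; _,_; proj₁)
open import Data.Unit using (⊤)
open import Relation.Nullary using (¬_)
open import Relation.Binary.PropositionalEquality using (_≡_; _≢_)

-- μ-types (locally nameless: free variables are names, bound ones are
-- de Bruijn indices).  Variables come in two kinds: datatype variables
-- (α, β, ...) and type variables (X, Y, ...).

data Kind : Set where
  Dk : Kind
  Tk : Kind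

Var : Set
Var = Kind × ℕ

infixr 6 _⊃_
infixl 7 _＠_
infixl 5 _⊕_

data Ty : Set where
  fv  : Var → Ty
  bv  : ℕ → Ty
  cst : ℕ → Ty
  _＠_ : Ty → Ty → Ty
  _⊃_ : Ty → Ty → Ty
  _⊕_ : Ty → Ty → Ty
  μ   : Kind → Ty → Ty

openT : ℕ → Ty → Ty → Ty
openT k U (fv V) = fv V
openT k U (bv j) = if j ≡ᵇ k then U else bv j
openT k U (cst c) = cst c
openT k U (A ＠ B) = openT k U A ＠ openT k U B
openT k U (A ⊃ B) = openT k U A ⊃ openT k U B
openT k U (A ⊕ B) = openT k U A ⊕ openT k U B
openT k U (μ κ A) = μ κ (openT (suc k) U A)

-- body of a μ with its binder instantiated:  A{V:=U}  for  μV.A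
inst : Ty → Ty → Ty
inst A U = openT 0 U A

_#_ : Var → Ty → Set
V # fv W = V ≢ W
V # bv _ = ⊤
V # cst _ = ⊤
V # (A ＠ B) = V # A × V # B
V # (A ⊃ B) = V # A × V # B
V # (A ⊕ B) = V # A × V # B
V # μ _ A = V # A

Guarded : ℕ → Ty → Set
Guarded i (fv _) = ⊤
Guarded i (bv j) = j ≢ i
Guarded i (cst _) = ⊤
Guarded i (_ ＠ _) = ⊤
Guarded i (_ ⊃ _) = ⊤
Guarded i (A ⊕ B) = Guarded i A × Guarded i B
Guarded i (μ _ A) = Guarded (suc i) A

data _∋_∶_ : List Kind → ℕ → Kind → Set where
  here  : ∀ {Δ k} → (k ∷ Δ) ∋ 0 ∶ k
  there : ∀ {Δ k k' i} → Δ ∋ i ∶ k → (k' ∷ Δ) ∋ suc i ∶ k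

-- well-formed (contractive) μ-datatypes D and μ-types A
mutual
  data DT (Δ : List Kind) : Ty → Set where
    dfv  : ∀ n → DT Δ (fv (Dk , n))
    dbv  : ∀ {i} → Δ ∋ i ∶ Dk → DT Δ (bv i)
    dcst : ∀ c → DT Δ (cst c)
    dapp : ∀ {D A} → DT Δ D → TW Δ A → DT Δ (D ＠ A)
    dor  : ∀ {D D'} → DT Δ D → DT Δ D' → DT Δ (D ⊕ D')
    dmu  : ∀ {D} → DT (Dk ∷ Δ) D → Guarded 0 D → DT Δ (μ Dk D)

  data TW (Δ : List Kind) : Ty → Set where
    tfv  : ∀ n → TW Δ (fv (Tk , n))
    tbv  : ∀ {i} → Δ ∋ i ∶ Tk → TW Δ (bv i)
    tdt  : ∀ {D} → DT Δ D → TW Δ D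
    tarr : ∀ {A B} → TW Δ A → TW Δ B → TW Δ (A ⊃ B)
    tor  : ∀ {A B} → TW Δ A → TW Δ B → TW Δ (A ⊕ B)
    tmu  : ∀ {A} → TW (Tk ∷ Δ) A → Guarded 0 A → TW Δ (μ Tk A)

IsDatatype : Ty → Set
IsDatatype = DT []

Wf : Ty → Set
Wf = TW []

infix 4 _≃_
data _≃_ : Ty → Ty → Set where
  ≃-refl  : ∀ {A} → Wf A → A ≃ A
  ≃-sym   : ∀ {A B} → A ≃ B → B ≃ A
  ≃-trans : ∀ {A B C} → A ≃ B → B ≃ C → A ≃ C
  ≃-arr   : ∀ {A A' B B'} → Wf (A ⊃ B) → Wf (A' ⊃ B') →
            A ≃ A' → B ≃ B' → (A ⊃ B) ≃ (A' ⊃ B')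
  ≃-app   : ∀ {A A' B B'} → Wf (A ＠ B) → Wf (A' ＠ B') →
            A ≃ A' → B ≃ B' → (A ＠ B) ≃ (A' ＠ B')
  ≃-or    : ∀ {A A' B B'} → Wf (A ⊕ B) → Wf (A' ⊕ B') →
            A ≃ A' → B ≃ B' → (A ⊕ B) ≃ (A' ⊕ B')
  ≃-mu    : ∀ {κ A B} n → Wf (μ κ A) → Wf (μ κ B) →
            (κ , n) # A → (κ , n) # B →
            inst A (fv (κ , n)) ≃ inst B (fv (κ , n)) → μ κ A ≃ μ κ B
  ≃-idem  : ∀ {A} → Wf (A ⊕ A) → (A ⊕ A) ≃ A
  ≃-comm  : ∀ {A B} → Wf (A ⊕ B) → (A ⊕ B) ≃ (B ⊕ A)
  ≃-assoc : ∀ {A B C} → Wf (A ⊕ (B ⊕ C)) → (A ⊕ (B ⊕ C)) ≃ ((A ⊕ B) ⊕ C)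
  ≃-unfold : ∀ {κ A} → Wf (μ κ A) → μ κ A ≃ inst A (μ κ A)
  ≃-fold  : ∀ {κ A B} → Wf A → Wf (μ κ B) →   -- Wf (μ κ B) includes contractiveness
            A ≃ inst B A → A ≃ μ κ B

AssumpCtx : Set
AssumpCtx = List (Var × Var)

_∉Σ_ : Var → AssumpCtx → Set
V ∉Σ [] = ⊤
V ∉Σ ((W , W') ∷ Σ) = V ≢ W × V ≢ W' × V ∉Σ Σ

infix 4 _⊢_≼_
data _⊢_≼_ (Σ : AssumpCtx) : Ty → Ty → Set where
  ≼-refl  : ∀ {A} → Wf A → Σ ⊢ A ≼ A
  ≼-hyp   : ∀ {V W} → (V , W) ∈ Σ → Σ ⊢ fv V ≼ fv W
  ≼-eq    : ∀ {A B} → A ≃ B → Σ ⊢ A ≼ B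
  ≼-trans : ∀ {A B C} → Σ ⊢ A ≼ B → Σ ⊢ B ≼ C → Σ ⊢ A ≼ C
  ≼-app   : ∀ {D D' A A'} → Wf (D ＠ A) → Wf (D' ＠ A') →
            Σ ⊢ D ≼ D' → Σ ⊢ A ≼ A' → Σ ⊢ D ＠ A ≼ D' ＠ A'
  ≼-arr   : ∀ {A A' B B'} → Wf (A' ⊃ B) → Wf (A ⊃ B') →
            Σ ⊢ A ≼ A' → Σ ⊢ B ≼ B' → Σ ⊢ A' ⊃ B ≼ A ⊃ B'
  ≼-orL   : ∀ {A B C} → Σ ⊢ A ≼ C → Σ ⊢ B ≼ C → Σ ⊢ A ⊕ B ≼ C
  ≼-orR₁  : ∀ {A B C} → Wf (B ⊕ C) → Σ ⊢ A ≼ B → Σ ⊢ A ≼ B ⊕ C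
  ≼-orR₂  : ∀ {A B C} → Wf (C ⊕ B) → Σ ⊢ A ≼ B → Σ ⊢ A ≼ C ⊕ B
  ≼-mu    : ∀ {κ κ' A B} n m → Wf (μ κ A) → Wf (μ κ' B) →
            (κ , n) # A → (κ' , m) # B →
            (κ , n) ∉Σ Σ → (κ' , m) ∉Σ Σ →
            (κ' , m) # inst A (fv (κ , n)) → (κ , n) # inst B (fv (κ' , m)) →
            (((κ , n) , (κ' , m)) ∷ Σ) ⊢ inst A (fv (κ , n)) ≼ inst B (fv (κ' , m)) →
            Σ ⊢ μ κ A ≼ μ κ' B

infix 4 _≼_
_≼_ : Ty → Ty → Set
A ≼ B = [] ⊢ A ≼ B

data Union : List Ty → Ty → Set where
  leaf : ∀ {A} → Union (A ∷ []) A
  node : ∀ {As Bs A B} → Union As A → Union Bs B → Union (As ++ Bs) (A ⊕ B)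

infixl 8 _∙_
data Pat : Set where
  pv  : ℕ → Pat
  pc  : ℕ → Pat
  _∙_ : Pat → Pat → Pat

fm : Pat → List ℕ
fm (pv x) = x ∷ []
fm (pc _) = []
fm (p ∙ q) = fm p ++ fm q

Linear : Pat → Set
Linear p = Unique (fm p)

substP : (ℕ → Pat) → Pat → Pat
substP σ (pv x) = σ x
substP σ (pc c) = pc c
substP σ (p ∙ q) = substP σ p ∙ substP σ q

Subsumes : Pat → Pat → Set
Subsumes p q = ∃ λ (σ : ℕ → Pat) → substP σ p ≡ q

data Dir : Set where
  d1 d2 : Dir

Pos : Set
Pos = List Dir

data At : Pat → Pos → Pat → Set where
  at-ε : ∀ {p} → At p [] p
  at-1 : ∀ {p q π r} → At p π r → At (p ∙ q) (d1 ∷ π) r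
  at-2 : ∀ {p q π r} → At q π r → At (p ∙ q) (d2 ∷ π) r

InMM : Pat → Pat → Pos → Set
InMM p q π =
  Σ Pat λ p' → Σ Pat λ q' → At p π p' × At q π q' × ¬ Subsumes p' q' ×
  (∀ ρ p'' q'' → ρ ≢ [] → At p (π ++ ρ) p'' → At q (π ++ ρ) q'' → Subsumes p'' q'')

data Sym : Set where
  svar : Var → Sym
  scst : ℕ → Sym
  s⊃ s＠ : Sym

data Adm : Ty → Pos → Sym → Set where
  adm-var : ∀ {V} → Adm (fv V) [] (svar V)
  adm-cst : ∀ {c} → Adm (cst c) [] (scst c)
  adm-arr : ∀ {A B} → Adm (A ⊃ B) [] s⊃
  adm-app : ∀ {A B} → Adm (A ＠ B) [] s＠
  adm-arr1 : ∀ {A B π a} → Adm A π a → Adm (A ⊃ B) (d1 ∷ π) a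
  adm-arr2 : ∀ {A B π a} → Adm B π a → Adm (A ⊃ B) (d2 ∷ π) a
  adm-app1 : ∀ {A B π a} → Adm A π a → Adm (A ＠ B) (d1 ∷ π) a
  adm-app2 : ∀ {A B π a} → Adm B π a → Adm (A ＠ B) (d2 ∷ π) a
  adm-orL : ∀ {A B π a} → Adm A π a → Adm (A ⊕ B) π a
  adm-orR : ∀ {A B π a} → Adm B π a → Adm (A ⊕ B) π a
  adm-mu  : ∀ {κ A π a} → Adm (inst A (μ κ A)) π a → Adm (μ κ A) π a

Ctx : Set
Ctx = List (ℕ × Ty)

lookupC : Ctx → ℕ → Maybe Ty
lookupC [] x = nothing
lookupC ((y , A) ∷ Γ) x = if x ≡ᵇ y then just A else lookupC Γ x

dom : Ctx → List ℕ
dom = map proj₁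

WfCtx : Ctx → Set
WfCtx [] = ⊤
WfCtx ((_ , A) ∷ θ) = Wf A × WfCtx θ

-- compatibility (the contexts θ, θ' play no role in the conditions)
Compatible : Pat × Ty → Pat × Ty → Set
Compatible (p , A) (q , B) =
  (Subsumes p q → B ≼ A) ×
  (¬ Subsumes p q →
     (∀ π → InMM p q π → ∃ λ a → Adm A π a × Adm B π a) → B ≼ A)

CompatibleList : List (Pat × Ty) → Set
CompatibleList = AllPairs Compatible

infix 4 _⊢p_∶_
data _⊢p_∶_ (θ : Ctx) : Pat → Ty → Set where
  pt-var : ∀ {x A} → lookupC θ x ≡ just A → θ ⊢p pv x ∶ A
  pt-con : ∀ {c} → θ ⊢p pc c ∶ cst c
  pt-app : ∀ {p q D A} → IsDatatype D → θ ⊢p p ∶ D → θ ⊢p q ∶ A → θ ⊢p p ∙ q ∶ D ＠ A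

infixl 8 _·_
data Term : Set where
  var : ℕ → Term
  con : ℕ → Term
  _·_ : Term → Term → Term
  abs : List (Pat × Ctx × Term) → Term     -- (p₁ →θ₁ t₁ | … | pₙ →θₙ tₙ)

Alt : Set
Alt = Pat × Ctx × Term

mutual
  data Value : Term → Set where
    val-head : ∀ {t} → Head t → Value t
    val-abs  : ∀ alts → Value (abs alts)

  data Head : Term → Set where
    h-var : ∀ x → Head (var x)
    h-con : ∀ c → Head (con c)
    h-app : ∀ {t v} → Head t → Value v → Head (t · v)

isData : Term → Bool
isData (con _) = true
isData (t · _) = isData t
isData _ = false

isMatchable : Term → Bool
isMatchable (abs _) = true
isMatchable t = isData t

Subst : Set
Subst = List (ℕ × Term)

lookupS : Subst → ℕ → Maybe Term
lookupS [] x = nothing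
lookupS ((y , u) ∷ σ) x = if x ≡ᵇ y then just u else lookupS σ x

elemℕ : ℕ → List ℕ → Bool
elemℕ x [] = false
elemℕ x (y ∷ ys) = (x ≡ᵇ y) ∨ elemℕ x ys

removeS : List ℕ → Subst → Subst
removeS xs [] = []
removeS xs ((y , u) ∷ σ) = if elemℕ y xs then removeS xs σ else (y , u) ∷ removeS xs σ

mutual
  subst : Subst → Term → Term
  subst σ (var x) with lookupS σ x
  ... | just u = u
  ... | nothing = var x
  subst σ (con c) = con c
  subst σ (t · u) = subst σ t · subst σ u
  subst σ (abs alts) = abs (substAlts σ alts)

  substAlts : Subst → List Alt → List Alt
  substAlts σ [] = []
  substAlts σ ((p , θ , s) ∷ alts) = (p , θ , subst (removeS (fm p) σ) s) ∷ substAlts σ alts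

data MatchRes : Set where
  ok   : Subst → MatchRes
  fail : MatchRes
  wait : MatchRes

_⊎m_ : MatchRes → MatchRes → MatchRes
fail ⊎m _ = fail
ok _ ⊎m fail = fail
wait ⊎m fail = fail
ok σ₁ ⊎m ok σ₂ = ok (σ₁ ++ σ₂)
ok _ ⊎m wait = wait
wait ⊎m ok _ = wait
wait ⊎m wait = wait

failOrWait : Term → MatchRes
failOrWait u = if isMatchable u then fail else wait

match : Pat → Term → MatchRes
match (pv x) u = ok ((x , u) ∷ [])
match (pc c) (con c') = if c ≡ᵇ c' then ok [] else fail
match (pc c) u = failOrWait u
match (p ∙ q) (u · v) = if isMatchable (u · v) then match p u ⊎m match q v else wait
match (p ∙ q) u = failOrWait u

data Select : List Alt → Term → Term → Set where
  sel-here  : ∀ {p θ s alts u σ} → match p u ≡ ok σ →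
              Select ((p , θ , s) ∷ alts) u (subst σ s)
  sel-there : ∀ {p θ s alts u t} → match p u ≡ fail → Select alts u t →
              Select ((p , θ , s) ∷ alts) u t

infix 4 _⟶_
mutual
  data _⟶_ : Term → Term → Set where
    β     : ∀ {alts u t} → Select alts u t → abs alts · u ⟶ t
    appL  : ∀ {r r' u} → r ⟶ r' → r · u ⟶ r' · u
    appR  : ∀ {r u u'} → u ⟶ u' → r · u ⟶ r · u'
    absC  : ∀ {alts alts'} → AltsStep alts alts' → abs alts ⟶ abs alts'

  data AltsStep : List Alt → List Alt → Set where
    alt-here  : ∀ {p θ s s' alts} → s ⟶ s' → AltsStep ((p , θ , s) ∷ alts) ((p , θ , s') ∷ alts)
    alt-there : ∀ {a alts alts'} → AltsStep alts alts' → AltsStep (a ∷ alts) (a ∷ alts')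

patTypes : List Alt → List Ty → List (Pat × Ty)
patTypes [] _ = []
patTypes _ [] = []
patTypes ((p , _ , _) ∷ alts) (A ∷ As) = (p , A) ∷ patTypes alts As

infix 4 _⊢_∶_
mutual
  data _⊢_∶_ (Γ : Ctx) : Term → Ty → Set where
    t-var : ∀ {x A} → lookupC Γ x ≡ just A → Γ ⊢ var x ∶ A
    t-con : ∀ {c} → Γ ⊢ con c ∶ cst c
    t-data : ∀ {r u D A} → IsDatatype D → Γ ⊢ r ∶ D → Γ ⊢ u ∶ A → Γ ⊢ r · u ∶ D ＠ A
    t-abs : ∀ {alts As T B} →
            AltsTyped Γ B alts As →
            CompatibleList (patTypes alts As) →
            Union As T →
            Γ ⊢ abs alts ∶ T ⊃ B
    t-app : ∀ {r u As T B A} → Γ ⊢ r ∶ T ⊃ B → Union As T → A ∈ As →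
            Γ ⊢ u ∶ A → Γ ⊢ r · u ∶ B
    t-sub : ∀ {s A A'} → Γ ⊢ s ∶ A → Wf A' → A ≼ A' → Γ ⊢ s ∶ A'

  data AltsTyped (Γ : Ctx) (B : Ty) : List Alt → List Ty → Set where
    []  : AltsTyped Γ B [] []
    _∷_ : ∀ {p θ s A alts As} →
          (Linear p × WfCtx θ × θ ⊢p p ∶ A ×
           (∀ x → (x ∈ dom θ → x ∈ fm p) × (x ∈ fm p → x ∈ dom θ)) ×
           (θ ++ Γ) ⊢ s ∶ B) →
          AltsTyped Γ B alts As →
          AltsTyped Γ B ((p , θ , s) ∷ alts) (A ∷ As)

-- A closed non-value is an application; if the function or the argument is
-- not a value it reduces by induction, and a data structure applied to a
-- value is a value.  What remains is a redex  abs alts · v  with v a closed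
-- value: matching v never waits, and we must exclude that every pattern fails.
-- For this we read types semantically: Fits η A u says that the constructor
-- structure of u is admitted by A (unfolding μ's), and ArrowDom η A S that A
-- has an arrow component whose domain only admits terms in S.  Both are
-- preserved by ≃ and ≼; the μ-rules are the hard cases, proved by induction on
-- term size (using contractiveness) through a substitution lemma for bound
-- type variables.  Then v fits the domain of the abstraction, hence one of its
-- pattern types, and a pattern matches every value fitting its type.

module Submission where

open import Defs
open import Data.Nat using (ℕ; zero; suc; _+_; _≤_; _<_; z≤n; s≤s; _≡ᵇ_) renaming (_≟_ to _≟ℕ_)
open import Data.Nat.Properties using (≡ᵇ⇒≡; ≡⇒≡ᵇ; ≤-refl; <-trans; m≤m+n; m≤n+m; +-suc; n<1+n; <-≤-trans; <⇒≢; +-identityʳ; +-cancelˡ-≡; 1+n≢0; 0≢1+n; ≤-pred; +-monoʳ-<)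
open import Data.Bool using (true; false)
open import Data.Bool.Properties using (T-≡; ¬-not)
open import Data.List using (List; []; _∷_; length)
open import Data.List.Membership.Propositional using (_∈_)
open import Data.List.Membership.Propositional.Properties using (∈-++⁻; ∈-++⁺ˡ; ∈-++⁺ʳ)
open import Data.List.Relation.Unary.Any using (here; there)
open import Data.Maybe using (Maybe; just; nothing; fromMaybe; _>>=_)
open import Data.Product using (Σ; ∃; _×_; _,_; proj₁; proj₂; zip′)
open import Data.Product.Properties using (≡-dec)
open import Data.Sum using (_⊎_; inj₁; inj₂)
open import Data.Unit using (⊤; tt)
open import Data.Empty using (⊥; ⊥-elim)
open import Function.Bundles using (Equivalence)
open import Relation.Nullary using (¬_; Dec; yes; no)
open import Relation.Binary.PropositionalEquality using (_≡_; _≢_; refl; sym; trans; cong; cong₂) renaming (subst to ≡subst)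

≡ᵇ-refl : ∀ n → (n ≡ᵇ n) ≡ true
≡ᵇ-refl n = Equivalence.to T-≡ (≡⇒≡ᵇ n n refl)

≡ᵇ-distinct : ∀ m n → m ≢ n → (m ≡ᵇ n) ≡ false
≡ᵇ-distinct m n m≢n = ¬-not (λ e → m≢n (≡ᵇ⇒≡ m n (Equivalence.from T-≡ e)))

-- Equality of variables is decidable (needed to single out equal binder
-- names in the μ-subtyping rule).
_≟K_ : (a b : Kind) → Dec (a ≡ b)
Dk ≟K Dk = yes refl
Dk ≟K Tk = no λ ()
Tk ≟K Dk = no λ ()
Tk ≟K Tk = yes refl

_≟V_ : (V W : Var) → Dec (V ≡ W)
_≟V_ = ≡-dec _≟K_ _≟ℕ_

-- Number of application nodes outside abstractions.  The μ-rules are proved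
-- by induction on it, since only ＠ makes Fits descend into a subterm.
size : Term → ℕ
size (t · u) = suc (size t + size u)
size (var _) = 0
size (con _) = 0
size (abs _) = 0

size-fun< : ∀ t u → size t < size (t · u)
size-fun< t u = s≤s (m≤m+n (size t) (size u))

size-arg< : ∀ t u → size u < size (t · u)
size-arg< t u = s≤s (m≤n+m (size u) (size t))

Env : Set₁
Env = Var → Term → Set

data Fits (η : Env) : Ty → Term → Set where
  f-var : ∀ {V u} → η V u → Fits η (fv V) u
  f-cst : ∀ {c} → Fits η (cst c) (con c)
  f-app : ∀ {D A r v} → Fits η D r → Fits η A v → Fits η (D ＠ A) (r · v)
  f-arr : ∀ {A B alts} → Fits η (A ⊃ B) (abs alts)
  f-orL : ∀ {A B u} → Fits η A u → Fits η (A ⊕ B) u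
  f-orR : ∀ {A B u} → Fits η B u → Fits η (A ⊕ B) u
  f-mu  : ∀ {κ A u} → Fits η (inst A (μ κ A)) u → Fits η (μ κ A) u

data ArrowDom (η : Env) : Ty → (Term → Set) → Set₁ where
  ad-arr : ∀ {T B S} → (∀ u → Fits η T u → S u) → ArrowDom η (T ⊃ B) S
  ad-orL : ∀ {A B S} → ArrowDom η A S → ArrowDom η (A ⊕ B) S
  ad-orR : ∀ {A B S} → ArrowDom η B S → ArrowDom η (A ⊕ B) S
  ad-mu  : ∀ {κ A S} → ArrowDom η (inst A (μ κ A)) S → ArrowDom η (μ κ A) S

_‼_ : List Ty → ℕ → Maybe Ty
[] ‼ _ = nothing
(T ∷ ρ) ‼ zero = just T
(T ∷ ρ) ‼ suc i = ρ ‼ i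

_∸?_ : ℕ → ℕ → Maybe ℕ
j ∸? zero = just j
zero ∸? suc k = nothing
suc j ∸? suc k = j ∸? k

substIx : Maybe ℕ → List Ty → ℕ → Ty
substIx m ρ j = fromMaybe (bv j) (m >>= (ρ ‼_))

-- substB k ρ A replaces the indices k, k+1, … (the variables bound outside
-- of k enclosing binders) by the types ρ.  Unfolding μ-types is the case
-- k = 0 with a single type (inst-substB).
substB : ℕ → List Ty → Ty → Ty
substB k ρ (fv V) = fv V
substB k ρ (bv j) = substIx (j ∸? k) ρ j
substB k ρ (cst c) = cst c
substB k ρ (A ＠ B) = substB k ρ A ＠ substB k ρ B
substB k ρ (A ⊃ B) = substB k ρ A ⊃ substB k ρ B
substB k ρ (A ⊕ B) = substB k ρ A ⊕ substB k ρ B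
substB k ρ (μ κ A) = μ κ (substB (suc k) ρ A)

ClosedAt : ℕ → Ty → Set
ClosedAt k (fv _) = ⊤
ClosedAt k (bv j) = j < k
ClosedAt k (cst _) = ⊤
ClosedAt k (A ＠ B) = ClosedAt k A × ClosedAt k B
ClosedAt k (A ⊃ B) = ClosedAt k A × ClosedAt k B
ClosedAt k (A ⊕ B) = ClosedAt k A × ClosedAt k B
ClosedAt k (μ _ A) = ClosedAt (suc k) A

AllClosed : List Ty → Set
AllClosed [] = ⊤
AllClosed (T ∷ ρ) = ClosedAt 0 T × AllClosed ρ

closedAt-mono : ∀ {k k'} T → ClosedAt k T → k ≤ k' → ClosedAt k' T
closedAt-mono (fv _) c le = tt
closedAt-mono (bv j) c le = <-≤-trans c le
closedAt-mono (cst _) c le = tt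
closedAt-mono (A ＠ B) (c1 , c2) le = closedAt-mono A c1 le , closedAt-mono B c2 le
closedAt-mono (A ⊃ B) (c1 , c2) le = closedAt-mono A c1 le , closedAt-mono B c2 le
closedAt-mono (A ⊕ B) (c1 , c2) le = closedAt-mono A c1 le , closedAt-mono B c2 le
closedAt-mono (μ _ A) c le = closedAt-mono A c (s≤s le)

open-closed : ∀ {k} j U T → ClosedAt k T → k ≤ j → openT j U T ≡ T
open-closed j U (fv V) c le = refl
open-closed j U (bv i) c le rewrite ≡ᵇ-distinct i j (<⇒≢ (<-≤-trans c le)) = refl
open-closed j U (cst _) c le = refl
open-closed j U (A ＠ B) (c1 , c2) le = cong₂ _＠_ (open-closed j U A c1 le) (open-closed j U B c2 le)
open-closed j U (A ⊃ B) (c1 , c2) le = cong₂ _⊃_ (open-closed j U A c1 le) (open-closed j U B c2 le)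
open-closed j U (A ⊕ B) (c1 , c2) le = cong₂ _⊕_ (open-closed j U A c1 le) (open-closed j U B c2 le)
open-closed j U (μ κ A) c le = cong (μ κ) (open-closed (suc j) U A c (s≤s le))

-- The index case of open-substB; o counts the binders already traversed.
open-substIx : ∀ W ρ → AllClosed ρ → ∀ k j o →
  openT (o + k) W (substIx (j ∸? suc k) ρ (o + j)) ≡ substIx (j ∸? k) (W ∷ ρ) (o + j)
open-substIx W ρ ac zero zero o rewrite ≡ᵇ-refl (o + 0) = refl
open-substIx W ρ ac zero (suc j) o = lookup-closed ρ ac j
  where
  lookup-closed : ∀ ρ → AllClosed ρ → ∀ i →
    openT (o + 0) W (fromMaybe (bv (o + suc j)) (ρ ‼ i)) ≡ fromMaybe (bv (o + suc j)) (ρ ‼ i)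
  lookup-closed [] _ i
    rewrite ≡ᵇ-distinct (o + suc j) (o + 0) (λ e → 1+n≢0 (+-cancelˡ-≡ o (suc j) 0 e)) = refl
  lookup-closed (T ∷ ρ) (c , _) zero = open-closed (o + 0) W T c z≤n
  lookup-closed (T ∷ ρ) (_ , ac) (suc i) = lookup-closed ρ ac i
open-substIx W ρ ac (suc k) zero o
  rewrite ≡ᵇ-distinct (o + 0) (o + suc k) (λ e → 0≢1+n (+-cancelˡ-≡ o 0 (suc k) e)) = refl
open-substIx W ρ ac (suc k) (suc j) o rewrite +-suc o k | +-suc o j = open-substIx W ρ ac k j (suc o)

open-substB : ∀ W ρ → AllClosed ρ → ∀ k Y → openT k W (substB (suc k) ρ Y) ≡ substB k (W ∷ ρ) Y
open-substB W ρ ac k (fv V) = refl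
open-substB W ρ ac k (bv j) = open-substIx W ρ ac k j 0
open-substB W ρ ac k (cst c) = refl
open-substB W ρ ac k (A ＠ B) = cong₂ _＠_ (open-substB W ρ ac k A) (open-substB W ρ ac k B)
open-substB W ρ ac k (A ⊃ B) = cong₂ _⊃_ (open-substB W ρ ac k A) (open-substB W ρ ac k B)
open-substB W ρ ac k (A ⊕ B) = cong₂ _⊕_ (open-substB W ρ ac k A) (open-substB W ρ ac k B)
open-substB W ρ ac k (μ κ A) = cong (μ κ) (open-substB W ρ ac (suc k) A)

substB-[] : ∀ k Y → substB k [] Y ≡ Y
substB-[] k (fv V) = refl
substB-[] k (bv j) with j ∸? k
... | nothing = refl
... | just i = refl
substB-[] k (cst c) = refl
substB-[] k (A ＠ B) = cong₂ _＠_ (substB-[] k A) (substB-[] k B)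
substB-[] k (A ⊃ B) = cong₂ _⊃_ (substB-[] k A) (substB-[] k B)
substB-[] k (A ⊕ B) = cong₂ _⊕_ (substB-[] k A) (substB-[] k B)
substB-[] k (μ κ A) = cong (μ κ) (substB-[] (suc k) A)

inst-substB : ∀ A U → inst A U ≡ substB 0 (U ∷ []) A
inst-substB A U = trans (cong (openT 0 U) (sym (substB-[] 1 A))) (open-substB U [] tt 0 A)

substIx-closed : ∀ ρ → AllClosed ρ → ∀ o k j → j < k + length ρ →
  ClosedAt (o + k) (substIx (j ∸? k) ρ (o + j))
substIx-closed ρ ac o zero j lt = closedAt-mono (substIx (just j) ρ (o + j)) (lookup-closed ρ ac j lt) z≤n
  where
  lookup-closed : ∀ ρ → AllClosed ρ → ∀ i → i < length ρ → ClosedAt 0 (substIx (just i) ρ (o + j))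
  lookup-closed (T ∷ ρ) (c , _) zero lt = c
  lookup-closed (T ∷ ρ) (_ , ac) (suc i) (s≤s lt) = lookup-closed ρ ac i lt
substIx-closed ρ ac o (suc k) zero lt = +-monoʳ-< o (s≤s z≤n)
substIx-closed ρ ac o (suc k) (suc j) (s≤s lt) rewrite +-suc o k | +-suc o j = substIx-closed ρ ac (suc o) k j lt

substB-closed : ∀ k ρ Y → AllClosed ρ → ClosedAt (k + length ρ) Y → ClosedAt k (substB k ρ Y)
substB-closed k ρ (fv V) ac c = tt
substB-closed k ρ (bv j) ac c = substIx-closed ρ ac 0 k j c
substB-closed k ρ (cst _) ac c = tt
substB-closed k ρ (A ＠ B) ac (c1 , c2) = substB-closed k ρ A ac c1 , substB-closed k ρ B ac c2
substB-closed k ρ (A ⊃ B) ac (c1 , c2) = substB-closed k ρ A ac c1 , substB-closed k ρ B ac c2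
substB-closed k ρ (A ⊕ B) ac (c1 , c2) = substB-closed k ρ A ac c1 , substB-closed k ρ B ac c2
substB-closed k ρ (μ _ A) ac c = substB-closed (suc k) ρ A ac c

Contractive : Ty → Set
Contractive (fv _) = ⊤
Contractive (bv _) = ⊤
Contractive (cst _) = ⊤
Contractive (A ＠ B) = Contractive A × Contractive B
Contractive (A ⊃ B) = Contractive A × Contractive B
Contractive (A ⊕ B) = Contractive A × Contractive B
Contractive (μ _ A) = Guarded 0 A × Contractive A

AllFree : (Var → Set) → Ty → Set
AllFree P (fv X) = P X
AllFree P (bv _) = ⊤
AllFree P (cst _) = ⊤
AllFree P (A ＠ B) = AllFree P A × AllFree P B
AllFree P (A ⊃ B) = AllFree P A × AllFree P B
AllFree P (A ⊕ B) = AllFree P A × AllFree P B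
AllFree P (μ _ A) = AllFree P A

allFree-every : ∀ {P : Var → Set} → (∀ X → P X) → ∀ Y → AllFree P Y
allFree-every f (fv X) = f X
allFree-every f (bv _) = tt
allFree-every f (cst _) = tt
allFree-every f (A ＠ B) = allFree-every f A , allFree-every f B
allFree-every f (A ⊃ B) = allFree-every f A , allFree-every f B
allFree-every f (A ⊕ B) = allFree-every f A , allFree-every f B
allFree-every f (μ _ A) = allFree-every f A

allFree-fresh : ∀ {P : Var → Set} {V W} Y → V # Y → W # Y → (∀ X → V ≢ X → W ≢ X → P X) → AllFree P Y
allFree-fresh (fv X) a b f = f X a b
allFree-fresh (bv _) a b f = tt
allFree-fresh (cst _) a b f = tt
allFree-fresh (A ＠ B) (a1 , a2) (b1 , b2) f = allFree-fresh A a1 b1 f , allFree-fresh B a2 b2 f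
allFree-fresh (A ⊃ B) (a1 , a2) (b1 , b2) f = allFree-fresh A a1 b1 f , allFree-fresh B a2 b2 f
allFree-fresh (A ⊕ B) (a1 , a2) (b1 , b2) f = allFree-fresh A a1 b1 f , allFree-fresh B a2 b2 f
allFree-fresh (μ _ A) a b f = allFree-fresh A a b f

#-unopen : ∀ {W} k U A → W # openT k U A → W # A
#-unopen k U (fv V) f = f
#-unopen k U (bv _) f = tt
#-unopen k U (cst _) f = tt
#-unopen k U (A ＠ B) (f1 , f2) = #-unopen k U A f1 , #-unopen k U B f2
#-unopen k U (A ⊃ B) (f1 , f2) = #-unopen k U A f1 , #-unopen k U B f2
#-unopen k U (A ⊕ B) (f1 , f2) = #-unopen k U A f1 , #-unopen k U B f2
#-unopen k U (μ _ A) f = #-unopen (suc k) U A f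

-- If opening with fv V leaves V fresh, index k does not occur, so the
-- opening does not depend on the type substituted.
open-vacuous : ∀ {V} k X Y A → V # openT k (fv V) A → openT k X A ≡ openT k Y A
open-vacuous k X Y (fv _) f = refl
open-vacuous k X Y (bv j) f with j ≡ᵇ k
... | true = ⊥-elim (f refl)
... | false = refl
open-vacuous k X Y (cst _) f = refl
open-vacuous k X Y (A ＠ B) (f1 , f2) = cong₂ _＠_ (open-vacuous k X Y A f1) (open-vacuous k X Y B f2)
open-vacuous k X Y (A ⊃ B) (f1 , f2) = cong₂ _⊃_ (open-vacuous k X Y A f1) (open-vacuous k X Y B f2)
open-vacuous k X Y (A ⊕ B) (f1 , f2) = cong₂ _⊕_ (open-vacuous k X Y A f1) (open-vacuous k X Y B f2)
open-vacuous k X Y (μ κ A) f = cong (μ κ) (open-vacuous (suc k) X Y A f)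

∋-bound : ∀ {Δ i k} → Δ ∋ i ∶ k → i < length Δ
∋-bound here = s≤s z≤n
∋-bound (there p) = s≤s (∋-bound p)

pair : ∀ {P Q R S : Set} → P × Q → R × S → (P × R) × (Q × S)
pair = zip′ _,_ _,_

mutual
  datatype-info : ∀ {Δ D} → DT Δ D → Contractive D × ClosedAt (length Δ) D
  datatype-info (dfv n) = tt , tt
  datatype-info (dbv p) = tt , ∋-bound p
  datatype-info (dcst c) = tt , tt
  datatype-info (dapp d a) = pair (datatype-info d) (type-info a)
  datatype-info (dor d e) = pair (datatype-info d) (datatype-info e)
  datatype-info (dmu d g) = (g , proj₁ (datatype-info d)) , proj₂ (datatype-info d)

  type-info : ∀ {Δ A} → TW Δ A → Contractive A × ClosedAt (length Δ) A
  type-info (tfv n) = tt , tt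
  type-info (tbv p) = tt , ∋-bound p
  type-info (tdt d) = datatype-info d
  type-info (tarr a b) = pair (type-info a) (type-info b)
  type-info (tor a b) = pair (type-info a) (type-info b)
  type-info (tmu a g) = (g , proj₁ (type-info a)) , proj₂ (type-info a)

wf-closed : ∀ {A} → Wf A → ClosedAt 0 A
wf-closed w = proj₂ (type-info w)

record MuBody (A : Ty) : Set where
  field
    guarded     : Guarded 0 A
    contractive : Contractive A
    closed      : ClosedAt 1 A

mu-body : ∀ {κ A} → Wf (μ κ A) → MuBody A
mu-body w with type-info w
... | (g , c) , cl = record { guarded = g ; contractive = c ; closed = cl }

data FitsRel (η₁ η₂ : Env) : List Ty → List Ty → List ℕ → Set where
  rnil  : FitsRel η₁ η₂ [] [] []
  rcons : ∀ {T₁ T₂ b ρ₁ ρ₂ bs} →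
          ClosedAt 0 T₁ → ClosedAt 0 T₂ → (∀ u → size u < b → Fits η₁ T₁ u → Fits η₂ T₂ u) →
          FitsRel η₁ η₂ ρ₁ ρ₂ bs → FitsRel η₁ η₂ (T₁ ∷ ρ₁) (T₂ ∷ ρ₂) (b ∷ bs)

fitsRel-length : ∀ {η₁ η₂ ρ₁ ρ₂ bs} → FitsRel η₁ η₂ ρ₁ ρ₂ bs → length ρ₁ ≡ length ρ₂
fitsRel-length rnil = refl
fitsRel-length (rcons _ _ _ r) = cong suc (fitsRel-length r)

fitsRel-closed₁ : ∀ {η₁ η₂ ρ₁ ρ₂ bs} → FitsRel η₁ η₂ ρ₁ ρ₂ bs → AllClosed ρ₁
fitsRel-closed₁ rnil = tt
fitsRel-closed₁ (rcons c _ _ r) = c , fitsRel-closed₁ r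

fitsRel-closed₂ : ∀ {η₁ η₂ ρ₁ ρ₂ bs} → FitsRel η₁ η₂ ρ₁ ρ₂ bs → AllClosed ρ₂
fitsRel-closed₂ rnil = tt
fitsRel-closed₂ (rcons _ c _ r) = c , fitsRel-closed₂ r

-- Usable n i Y bs : for a term of size n, each substituted variable
-- (index i, i+1, … in Y) may be used: either n is below its bound, or n
-- equals its bound and the variable is guarded in Y, so it can only be
-- reached after descending into a strictly smaller subterm.
Usable : ℕ → ℕ → Ty → List ℕ → Set
Usable n i Y [] = ⊤
Usable n i Y (b ∷ bs) = (n < b ⊎ (n ≤ b × Guarded i Y)) × Usable n (suc i) Y bs

usable-μ : ∀ {n κ Y} i bs → Usable n i (μ κ Y) bs → Usable n (suc i) Y bs
usable-μ i [] _ = tt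
usable-μ i (b ∷ bs) (x , r) = x , usable-μ (suc i) bs r

usable-⊕ˡ : ∀ {n A B} i bs → Usable n i (A ⊕ B) bs → Usable n i A bs
usable-⊕ˡ i [] _ = tt
usable-⊕ˡ i (b ∷ bs) (inj₁ x , r) = inj₁ x , usable-⊕ˡ (suc i) bs r
usable-⊕ˡ i (b ∷ bs) (inj₂ (x , g) , r) = inj₂ (x , proj₁ g) , usable-⊕ˡ (suc i) bs r

usable-⊕ʳ : ∀ {n A B} i bs → Usable n i (A ⊕ B) bs → Usable n i B bs
usable-⊕ʳ i [] _ = tt
usable-⊕ʳ i (b ∷ bs) (inj₁ x , r) = inj₁ x , usable-⊕ʳ (suc i) bs r
usable-⊕ʳ i (b ∷ bs) (inj₂ (x , g) , r) = inj₂ (x , proj₂ g) , usable-⊕ʳ (suc i) bs r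

usable-smaller : ∀ {n m Y Y'} i bs → m < n → Usable n i Y bs → Usable m i Y' bs
usable-smaller i [] lt _ = tt
usable-smaller i (b ∷ bs) lt (inj₁ x , r) = inj₁ (<-trans lt x) , usable-smaller (suc i) bs lt r
usable-smaller i (b ∷ bs) lt (inj₂ (x , _) , r) = inj₁ (<-≤-trans lt x) , usable-smaller (suc i) bs lt r

-- The variable case: a usable variable is unguarded, hence below its bound.
fits-substIx : ∀ {η₁ η₂ ρ₁ ρ₂ bs u} i J → FitsRel η₁ η₂ ρ₁ ρ₂ bs → Usable (size u) i (bv (i + J)) bs →
  Fits η₁ (substIx (just J) ρ₁ (i + J)) u → Fits η₂ (substIx (just J) ρ₂ (i + J)) u
fits-substIx i J rnil _ ()
fits-substIx i zero (rcons _ _ r _) (inj₁ lt , _) d = r _ lt d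
fits-substIx i zero (rcons _ _ _ _) (inj₂ (_ , g) , _) d = ⊥-elim (g (+-identityʳ i))
fits-substIx i (suc J) (rcons _ _ _ R) (_ , us) d rewrite +-suc i J = fits-substIx (suc i) J R us d

-- Recursion
-- is on the fuel n > size u and then on Y; unfolding a μ adds the μ-type
-- itself to the substitution, related on strictly smaller terms by a
-- recursive call with less fuel.  The equation T ≡ substB 0 ρ₁ Y lets us
-- match on the derivation of Fits η₁ T u.
fits-substB : ∀ n {η₁ η₂ ρ₁ ρ₂ bs} Y {T u} → size u < n → FitsRel η₁ η₂ ρ₁ ρ₂ bs →
  AllFree (λ X → ∀ w → η₁ X w → η₂ X w) Y → ClosedAt (length ρ₁) Y → Contractive Y →
  Usable (size u) 0 Y bs → T ≡ substB 0 ρ₁ Y → Fits η₁ T u → Fits η₂ (substB 0 ρ₂ Y) u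
fits-substB zero Y () R f c co us e d
fits-substB (suc m) (fv X) lt R f c co us refl (f-var p) = f-var (f _ p)
fits-substB (suc m) (bv J) lt R f c co us refl d = fits-substIx 0 J R us d
fits-substB (suc m) (cst _) lt R f c co us refl f-cst = f-cst
fits-substB (suc m) {bs = bs} (A ＠ B) lt R (f1 , f2) (c1 , c2) (co1 , co2) us refl (f-app {r = r} {v = v} dr dv) =
  f-app (fits-substB (suc m) A (<-trans (size-fun< r v) lt) R f1 c1 co1 (usable-smaller 0 bs (size-fun< r v) us) refl dr)
        (fits-substB (suc m) B (<-trans (size-arg< r v) lt) R f2 c2 co2 (usable-smaller 0 bs (size-arg< r v) us) refl dv)
fits-substB (suc m) (A ⊃ B) lt R f c co us refl f-arr = f-arr
fits-substB (suc m) {bs = bs} (A ⊕ B) lt R (f1 , _) (c1 , _) (co1 , _) us refl (f-orL d) =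
  f-orL (fits-substB (suc m) A lt R f1 c1 co1 (usable-⊕ˡ 0 bs us) refl d)
fits-substB (suc m) {bs = bs} (A ⊕ B) lt R (_ , f2) (_ , c2) (_ , co2) us refl (f-orR d) =
  f-orR (fits-substB (suc m) B lt R f2 c2 co2 (usable-⊕ʳ 0 bs us) refl d)
fits-substB (suc m) {η₁} {η₂} {ρ₁} {ρ₂} {bs} (μ κ Y) {u = u} lt R f c (g , co) us refl (f-mu d) =
  f-mu (≡subst (λ Z → Fits η₂ Z u) (sym (open-substB (μ κ (substB 1 ρ₂ Y)) ρ₂ (fitsRel-closed₂ R) 0 Y))
    (fits-substB (suc m) Y lt R' f c co (inj₂ (≤-refl , g) , usable-μ 0 bs us)
      (open-substB (μ κ (substB 1 ρ₁ Y)) ρ₁ (fitsRel-closed₁ R) 0 Y) d))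
  where
  R' : FitsRel η₁ η₂ (μ κ (substB 1 ρ₁ Y) ∷ ρ₁) (μ κ (substB 1 ρ₂ Y) ∷ ρ₂) (size u ∷ bs)
  R' = rcons (substB-closed 1 ρ₁ Y (fitsRel-closed₁ R) c)
             (substB-closed 1 ρ₂ Y (fitsRel-closed₂ R) (≡subst (λ l → ClosedAt (suc l) Y) (fitsRel-length R) c))
             (λ w lw dw → fits-substB m (μ κ Y) (<-≤-trans lw (≤-pred lt)) R f c (g , co)
                                      (usable-smaller 0 bs lw us) refl dw)
             R

-- η with V interpreted by P and W by Q (by P ∪ Q when V = W).
data Bind (η : Env) (V : Var) (P : Term → Set) (W : Var) (Q : Term → Set) : Var → Term → Set where
  at-V      : ∀ {u} → P u → Bind η V P W Q V u
  at-W      : ∀ {u} → Q u → Bind η V P W Q W u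
  elsewhere : ∀ {X u} → V ≢ X → W ≢ X → η X u → Bind η V P W Q X u

bind-agrees : ∀ {η V P W Q X u} → V ≢ X → W ≢ X → Bind η V P W Q X u → η X u
bind-agrees V≢V _ (at-V _) = ⊥-elim (V≢V refl)
bind-agrees _ W≢W (at-W _) = ⊥-elim (W≢W refl)
bind-agrees _ _ (elsewhere _ _ p) = p

-- Induction on the size of the term: as A is contractive,
-- V is only reached in strictly smaller subterms, where the induction
-- hypothesis applies.
fits-μ : ∀ {κ κ' A B V W η} → Wf (μ κ A) → Wf (μ κ' B) → V # A → W # A → V # B → W # B →
  (∀ u → Fits (Bind η V (Fits η (μ κ' B)) W (Fits η (μ κ' B))) (inst A (fv V)) u →
         Fits (Bind η V (Fits η (μ κ' B)) W (Fits η (μ κ' B))) (inst B (fv W)) u) →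
  ∀ u → Fits η (μ κ A) u → Fits η (μ κ' B) u
fits-μ {κ} {κ'} {A} {B} {V} {W} {η} wA wB V#A W#A V#B W#B body u₀ d₀ = go (suc (size u₀)) u₀ (n<1+n _) d₀
  where
  Q = Fits η (μ κ' B)
  η' = Bind η V Q W Q
  module A = MuBody (mu-body wA)
  module B = MuBody (mu-body wB)
  at-binder : ∀ {w} → Bind η V Q W Q W w → Q w
  at-binder (at-V q) = q
  at-binder (at-W q) = q
  at-binder (elsewhere _ W≢W _) = ⊥-elim (W≢W refl)
  go : ∀ n u → size u < n → Fits η (μ κ A) u → Fits η (μ κ' B) u
  go zero u () d
  go (suc m) u lt (f-mu d) = f-mu (≡subst (λ Z → Fits η Z u) (sym (inst-substB B (μ κ' B))) unfoldB)
    where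
    -- the unfolding of μV.A fits A with V read as μW.B on smaller terms
    bodyA : Fits η' (inst A (fv V)) u
    bodyA = ≡subst (λ Z → Fits η' Z u) (sym (inst-substB A (fv V)))
              (fits-substB (suc m) A lt
                 (rcons A.closed tt (λ w lw dw → f-var (at-V (go m w (<-≤-trans lw (≤-pred lt)) dw))) rnil)
                 (allFree-fresh A V#A W#A (λ X V≢X W≢X w p → elsewhere V≢X W≢X p))
                 A.closed A.contractive (inj₂ (≤-refl , A.guarded) , tt) (inst-substB A (μ κ A)) d)
    -- reading W back as μW.B gives the unfolding of μW.B
    unfoldB : Fits η (substB 0 (μ κ' B ∷ []) B) u
    unfoldB = fits-substB (suc (size u)) B (n<1+n _)
                (rcons tt B.closed (λ { w _ (f-var p) → at-binder p }) rnil)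
                (allFree-fresh B V#B W#B (λ X V≢X W≢X w p → bind-agrees V≢X W≢X p))
                B.closed B.contractive (inj₁ (n<1+n _) , tt) (inst-substB B (fv W)) (body u bodyA)

SameFits : Env → Ty → Ty → Set
SameFits η A B = ∀ u → (Fits η A u → Fits η B u) × (Fits η B u → Fits η A u)

-- Type equivalence preserves Fits.  The folding rule A ≃ μV.B (from
-- A ≃ B{V:=A}) is again proved by induction on the size of the term.
≃-fits : ∀ {A B} → A ≃ B → ∀ η → SameFits η A B
≃-fits (≃-refl _) η u = (λ d → d) , (λ d → d)
≃-fits (≃-sym e) η u = proj₂ (≃-fits e η u) , proj₁ (≃-fits e η u)
≃-fits (≃-trans e1 e2) η u = (λ d → proj₁ (≃-fits e2 η u) (proj₁ (≃-fits e1 η u) d)) ,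
                             (λ d → proj₂ (≃-fits e1 η u) (proj₂ (≃-fits e2 η u) d))
≃-fits (≃-arr _ _ _ _) η u = (λ { f-arr → f-arr }) , (λ { f-arr → f-arr })
≃-fits (≃-app _ _ e1 e2) η u =
  (λ { (f-app a b) → f-app (proj₁ (≃-fits e1 η _) a) (proj₁ (≃-fits e2 η _) b) }) ,
  (λ { (f-app a b) → f-app (proj₂ (≃-fits e1 η _) a) (proj₂ (≃-fits e2 η _) b) })
≃-fits (≃-or _ _ e1 e2) η u =
  (λ { (f-orL a) → f-orL (proj₁ (≃-fits e1 η u) a) ; (f-orR b) → f-orR (proj₁ (≃-fits e2 η u) b) }) ,
  (λ { (f-orL a) → f-orL (proj₂ (≃-fits e1 η u) a) ; (f-orR b) → f-orR (proj₂ (≃-fits e2 η u) b) })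
≃-fits (≃-mu {κ} {A} {B} n wA wB A# B# e) η u =
  fits-μ wA wB A# A# B# B# (λ w → proj₁ (≃-fits e (Bind η V (Fits η (μ κ B)) V (Fits η (μ κ B))) w)) u ,
  fits-μ wB wA B# B# A# A# (λ w → proj₂ (≃-fits e (Bind η V (Fits η (μ κ A)) V (Fits η (μ κ A))) w)) u
  where V = (κ , n)
≃-fits (≃-idem _) η u = (λ { (f-orL a) → a ; (f-orR a) → a }) , f-orL
≃-fits (≃-comm _) η u = (λ { (f-orL a) → f-orR a ; (f-orR a) → f-orL a }) ,
                        (λ { (f-orL a) → f-orR a ; (f-orR a) → f-orL a })
≃-fits (≃-assoc _) η u =
  (λ { (f-orL a) → f-orL (f-orL a) ; (f-orR (f-orL a)) → f-orL (f-orR a) ; (f-orR (f-orR a)) → f-orR a }) ,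
  (λ { (f-orL (f-orL a)) → f-orL a ; (f-orL (f-orR a)) → f-orR (f-orL a) ; (f-orR a) → f-orR (f-orR a) })
≃-fits (≃-unfold _) η u = (λ { (f-mu d) → d }) , f-mu
≃-fits (≃-fold {κ} {A} {B} wA wB e) η u₀ = go (suc (size u₀)) u₀ (n<1+n _)
  where
  module B = MuBody (mu-body wB)
  unfold-agree : ∀ {m u T₁ T₂} → size u < suc m → ClosedAt 0 T₁ → ClosedAt 0 T₂ →
    (∀ w → size w < size u → Fits η T₁ w → Fits η T₂ w) →
    Fits η (inst B T₁) u → Fits η (inst B T₂) u
  unfold-agree {m} {u} {T₁} {T₂} lt c₁ c₂ below d =
    ≡subst (λ Z → Fits η Z u) (sym (inst-substB B T₂))
      (fits-substB (suc m) B lt (rcons c₁ c₂ below rnil) (allFree-every (λ _ _ p → p) B)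
         B.closed B.contractive (inj₂ (≤-refl , B.guarded) , tt) (inst-substB B T₁) d)
  go : ∀ n u → size u < n → (Fits η A u → Fits η (μ κ B) u) × (Fits η (μ κ B) u → Fits η A u)
  go zero u ()
  go (suc m) u lt =
    (λ d → f-mu (unfold-agree lt (wf-closed wA) B.closed
                   (λ w lw → proj₁ (go m w (<-≤-trans lw (≤-pred lt)))) (proj₁ (≃-fits e η u) d))) ,
    (λ { (f-mu d) → proj₂ (≃-fits e η u) (unfold-agree lt B.closed (wf-closed wA)
                   (λ w lw → proj₂ (go m w (<-≤-trans lw (≤-pred lt)))) d) })

Respects : AssumpCtx → Env → Set
Respects Σ η = ∀ {V W} → (V , W) ∈ Σ → ∀ u → η V u → η W u

∉Σ-mem : ∀ {V X Y Σ} → V ∉Σ Σ → (X , Y) ∈ Σ → V ≢ X × V ≢ Y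
∉Σ-mem (V≢X , V≢Y , _) (here refl) = V≢X , V≢Y
∉Σ-mem (_ , _ , r) (there m) = ∉Σ-mem r m

-- Binding variables not mentioned in Σ keeps Σ valid; the new assumption
-- V ≼ W has to be checked separately.
respects-bind : ∀ {Σ η V P W Q} → V ∉Σ Σ → W ∉Σ Σ → Respects Σ η →
  (∀ u → Bind η V P W Q V u → Bind η V P W Q W u) → Respects ((V , W) ∷ Σ) (Bind η V P W Q)
respects-bind V∉ W∉ h new (here refl) = new
respects-bind V∉ W∉ h new (there mem) w p with ∉Σ-mem V∉ mem | ∉Σ-mem W∉ mem
... | V≢X , V≢Y | W≢X , W≢Y = elsewhere V≢Y W≢Y (h mem w (bind-agrees V≢X W≢X p))

≼-fits : ∀ {Σ A B} → Σ ⊢ A ≼ B → ∀ η → Respects Σ η → ∀ u → Fits η A u → Fits η B u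
≼-fits (≼-refl _) η h u d = d
≼-fits (≼-hyp m) η h u (f-var p) = f-var (h m u p)
≼-fits (≼-eq e) η h u d = proj₁ (≃-fits e η u) d
≼-fits (≼-trans s1 s2) η h u d = ≼-fits s2 η h u (≼-fits s1 η h u d)
≼-fits (≼-app _ _ s1 s2) η h _ (f-app a b) = f-app (≼-fits s1 η h _ a) (≼-fits s2 η h _ b)
≼-fits (≼-arr _ _ _ _) η h u f-arr = f-arr
≼-fits (≼-orL s1 s2) η h u (f-orL d) = ≼-fits s1 η h u d
≼-fits (≼-orL s1 s2) η h u (f-orR d) = ≼-fits s2 η h u d
≼-fits (≼-orR₁ _ s) η h u d = f-orL (≼-fits s η h u d)
≼-fits (≼-orR₂ _ s) η h u d = f-orR (≼-fits s η h u d)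
≼-fits (≼-mu {κ} {κ'} {A} {B} n m wA wB A# B# V∉ W∉ W#A V#B s) η h u d =
  fits-μ wA wB A# (#-unopen 0 (fv (κ , n)) A W#A) (#-unopen 0 (fv (κ' , m)) B V#B) B#
    (λ w → ≼-fits s _ (respects-bind V∉ W∉ h (λ _ → to-W)) w) u d
  where
  Q = Fits η (μ κ' B)
  to-W : ∀ {w} → Bind η (κ , n) Q (κ' , m) Q (κ , n) w → Bind η (κ , n) Q (κ' , m) Q (κ' , m) w
  to-W (at-V q) = at-W q
  to-W (at-W q) = at-W q
  to-W (elsewhere V≢V _ _) = ⊥-elim (V≢V refl)

-- DomRel η₁ η₂ ρ₁ ρ₂ : the i-th types of ρ₁ and ρ₂ are closed and every term
-- fitting the second fits the first (arrow domains are contravariant).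
data DomRel (η₁ η₂ : Env) : List Ty → List Ty → Set where
  dnil  : DomRel η₁ η₂ [] []
  dcons : ∀ {T₁ T₂ ρ₁ ρ₂} → ClosedAt 0 T₁ → ClosedAt 0 T₂ → (∀ u → Fits η₂ T₂ u → Fits η₁ T₁ u) →
          DomRel η₁ η₂ ρ₁ ρ₂ → DomRel η₁ η₂ (T₁ ∷ ρ₁) (T₂ ∷ ρ₂)

domRel-length : ∀ {η₁ η₂ ρ₁ ρ₂} → DomRel η₁ η₂ ρ₁ ρ₂ → length ρ₁ ≡ length ρ₂
domRel-length dnil = refl
domRel-length (dcons _ _ _ r) = cong suc (domRel-length r)

domRel-closed₁ : ∀ {η₁ η₂ ρ₁ ρ₂} → DomRel η₁ η₂ ρ₁ ρ₂ → AllClosed ρ₁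
domRel-closed₁ dnil = tt
domRel-closed₁ (dcons c _ _ r) = c , domRel-closed₁ r

domRel-closed₂ : ∀ {η₁ η₂ ρ₁ ρ₂} → DomRel η₁ η₂ ρ₁ ρ₂ → AllClosed ρ₂
domRel-closed₂ dnil = tt
domRel-closed₂ (dcons _ c _ r) = c , domRel-closed₂ r

domRel-fitsRel : ∀ {η₁ η₂ ρ₁ ρ₂} → DomRel η₁ η₂ ρ₁ ρ₂ → ∀ n →
  Σ (List ℕ) λ bs → FitsRel η₂ η₁ ρ₂ ρ₁ bs × ∀ i Y → Usable n i Y bs
domRel-fitsRel dnil n = [] , rnil , λ _ _ → tt
domRel-fitsRel (dcons c₁ c₂ r R) n with domRel-fitsRel R n
... | bs , R' , us = suc n ∷ bs , rcons c₂ c₁ (λ u _ → r u) R' , λ i Y → inj₁ (n<1+n n) , us (suc i) Y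

domRel-fits : ∀ {η₁ η₂ ρ₁ ρ₂} → DomRel η₁ η₂ ρ₁ ρ₂ → ∀ A →
  AllFree (λ X → ∀ w → η₂ X w → η₁ X w) A → ClosedAt (length ρ₁) A → Contractive A →
  ∀ w → Fits η₂ (substB 0 ρ₂ A) w → Fits η₁ (substB 0 ρ₁ A) w
domRel-fits R A f c co w d with domRel-fitsRel R (size w)
... | bs , R' , us = fits-substB (suc (size w)) A (n<1+n _) R' f
                       (≡subst (λ l → ClosedAt l A) (domRel-length R) c) co (us 0 A) refl d

-- AllGuarded i Y ρ : each substituted index i, i+1, … is guarded in Y.
-- ArrowDom never descends into subterms, so it never reaches such a variable.
AllGuarded : ℕ → Ty → List Ty → Set
AllGuarded i Y [] = ⊤
AllGuarded i Y (_ ∷ ρ) = Guarded i Y × AllGuarded (suc i) Y ρ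

allGuarded-μ : ∀ {κ Y} i ρ → AllGuarded i (μ κ Y) ρ → AllGuarded (suc i) Y ρ
allGuarded-μ i [] _ = tt
allGuarded-μ i (_ ∷ ρ) (g , r) = g , allGuarded-μ (suc i) ρ r

allGuarded-⊕ˡ : ∀ {A B} i ρ → AllGuarded i (A ⊕ B) ρ → AllGuarded i A ρ
allGuarded-⊕ˡ i [] _ = tt
allGuarded-⊕ˡ i (_ ∷ ρ) (g , r) = proj₁ g , allGuarded-⊕ˡ (suc i) ρ r

allGuarded-⊕ʳ : ∀ {A B} i ρ → AllGuarded i (A ⊕ B) ρ → AllGuarded i B ρ
allGuarded-⊕ʳ i [] _ = tt
allGuarded-⊕ʳ i (_ ∷ ρ) (g , r) = proj₂ g , allGuarded-⊕ʳ (suc i) ρ r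

allGuarded-bv : ∀ i J ρ → AllGuarded i (bv (i + J)) ρ → J < length ρ → ⊥
allGuarded-bv i zero (_ ∷ ρ) (g , _) lt = g (+-identityʳ i)
allGuarded-bv i (suc J) (_ ∷ ρ) (_ , r) lt rewrite +-suc i J = allGuarded-bv (suc i) J ρ r (≤-pred lt)

arrowDom-substB : ∀ {η₁ η₂ ρ₁ ρ₂} Y {T S} → DomRel η₁ η₂ ρ₁ ρ₂ →
  AllFree (λ X → ∀ w → η₂ X w → η₁ X w) Y → ClosedAt (length ρ₁) Y → Contractive Y →
  AllGuarded 0 Y ρ₁ → T ≡ substB 0 ρ₁ Y → ArrowDom η₁ T S → ArrowDom η₂ (substB 0 ρ₂ Y) S
arrowDom-substB (fv X) R f c co g refl ()
arrowDom-substB {ρ₁ = ρ₁} (bv J) R f c co g refl d = ⊥-elim (allGuarded-bv 0 J ρ₁ g c)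
arrowDom-substB (cst _) R f c co g refl ()
arrowDom-substB (A ＠ B) R f c co g refl ()
arrowDom-substB (A ⊃ B) R (f1 , _) (c1 , _) (co1 , _) g refl (ad-arr h) =
  ad-arr (λ w d → h w (domRel-fits R A f1 c1 co1 w d))
arrowDom-substB {ρ₁ = ρ₁} (A ⊕ B) R (f1 , _) (c1 , _) (co1 , _) g refl (ad-orL d) =
  ad-orL (arrowDom-substB A R f1 c1 co1 (allGuarded-⊕ˡ 0 ρ₁ g) refl d)
arrowDom-substB {ρ₁ = ρ₁} (A ⊕ B) R (_ , f2) (_ , c2) (_ , co2) g refl (ad-orR d) =
  ad-orR (arrowDom-substB B R f2 c2 co2 (allGuarded-⊕ʳ 0 ρ₁ g) refl d)
arrowDom-substB {η₁} {η₂} {ρ₁} {ρ₂} (μ κ Y) {S = S} R f c (g₀ , co) g refl (ad-mu d) =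
  ad-mu (≡subst (λ Z → ArrowDom η₂ Z S) (sym (open-substB (μ κ (substB 1 ρ₂ Y)) ρ₂ (domRel-closed₂ R) 0 Y))
    (arrowDom-substB Y R' f c co (g₀ , allGuarded-μ 0 ρ₁ g)
       (open-substB (μ κ (substB 1 ρ₁ Y)) ρ₁ (domRel-closed₁ R) 0 Y) d))
  where
  R' : DomRel η₁ η₂ (μ κ (substB 1 ρ₁ Y) ∷ ρ₁) (μ κ (substB 1 ρ₂ Y) ∷ ρ₂)
  R' = dcons (substB-closed 1 ρ₁ Y (domRel-closed₁ R) c)
             (substB-closed 1 ρ₂ Y (domRel-closed₂ R) (≡subst (λ l → ClosedAt (suc l) Y) (domRel-length R) c))
             (domRel-fits R (μ κ Y) f c (g₀ , co)) R

-- The μ-rules are sound for ArrowDom: binders are read as the respective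
-- μ-types (V by μV.A, W by μW.B; when V = W, μW.B must be included in μV.A).
arrowDom-μ : ∀ {κ κ' A B V W η S} → Wf (μ κ A) → Wf (μ κ' B) → V # A → W # A → V # B → W # B →
  (V ≡ W → ∀ w → Fits η (μ κ' B) w → Fits η (μ κ A) w) →
  (∀ S' → ArrowDom (Bind η V (Fits η (μ κ A)) W (Fits η (μ κ' B))) (inst A (fv V)) S' →
          ArrowDom (Bind η V (Fits η (μ κ A)) W (Fits η (μ κ' B))) (inst B (fv W)) S') →
  ArrowDom η (μ κ A) S → ArrowDom η (μ κ' B) S
arrowDom-μ {κ} {κ'} {A} {B} {V} {W} {η} {S} wA wB V#A W#A V#B W#B same body (ad-mu d) =
  ad-mu (≡subst (λ Z → ArrowDom η Z S) (sym (inst-substB B (μ κ' B))) unfoldB)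
  where
  Qa = Fits η (μ κ A)
  Qb = Fits η (μ κ' B)
  η' = Bind η V Qa W Qb
  module A = MuBody (mu-body wA)
  module B = MuBody (mu-body wB)
  at-binder : ∀ {w} → η' V w → Qa w
  at-binder (at-V q) = q
  at-binder (at-W q) = same refl _ q
  at-binder (elsewhere V≢V _ _) = ⊥-elim (V≢V refl)
  -- the arrow domain of the unfolding of μV.A is one of A{V:=V}
  bodyA : ArrowDom η' (inst A (fv V)) S
  bodyA = ≡subst (λ Z → ArrowDom η' Z S) (sym (inst-substB A (fv V)))
            (arrowDom-substB A (dcons A.closed tt (λ { w (f-var p) → at-binder p }) dnil)
               (allFree-fresh A V#A W#A (λ X V≢X W≢X w p → bind-agrees V≢X W≢X p))
               A.closed A.contractive (A.guarded , tt) (inst-substB A (μ κ A)) d)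
  -- and, by the premise, one of B{W:=W}, hence of the unfolding of μW.B
  unfoldB : ArrowDom η (substB 0 (μ κ' B ∷ []) B) S
  unfoldB = arrowDom-substB B (dcons tt B.closed (λ w q → f-var (at-W q)) dnil)
              (allFree-fresh B V#B W#B (λ X V≢X W≢X w p → elsewhere V≢X W≢X p))
              B.closed B.contractive (B.guarded , tt) (inst-substB B (fv W)) (body S bodyA)

SameArrowDom : Env → Ty → Ty → Set₁
SameArrowDom η A B = ∀ S → (ArrowDom η A S → ArrowDom η B S) × (ArrowDom η B S → ArrowDom η A S)

-- Type equivalence preserves ArrowDom; the folding rule uses the Fits
-- soundness of the same equivalence for the arrow domains.
≃-arrowDom : ∀ {A B} → A ≃ B → ∀ η → SameArrowDom η A B
≃-arrowDom (≃-refl _) η S = (λ d → d) , (λ d → d)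
≃-arrowDom (≃-sym e) η S = proj₂ (≃-arrowDom e η S) , proj₁ (≃-arrowDom e η S)
≃-arrowDom (≃-trans e1 e2) η S = (λ d → proj₁ (≃-arrowDom e2 η S) (proj₁ (≃-arrowDom e1 η S) d)) ,
                                 (λ d → proj₂ (≃-arrowDom e1 η S) (proj₂ (≃-arrowDom e2 η S) d))
≃-arrowDom (≃-arr _ _ e1 _) η S =
  (λ { (ad-arr f) → ad-arr (λ w d → f w (proj₂ (≃-fits e1 η w) d)) }) ,
  (λ { (ad-arr f) → ad-arr (λ w d → f w (proj₁ (≃-fits e1 η w) d)) })
≃-arrowDom (≃-app _ _ _ _) η S = (λ ()) , (λ ())
≃-arrowDom (≃-or _ _ e1 e2) η S =
  (λ { (ad-orL a) → ad-orL (proj₁ (≃-arrowDom e1 η S) a) ; (ad-orR b) → ad-orR (proj₁ (≃-arrowDom e2 η S) b) }) ,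
  (λ { (ad-orL a) → ad-orL (proj₂ (≃-arrowDom e1 η S) a) ; (ad-orR b) → ad-orR (proj₂ (≃-arrowDom e2 η S) b) })
≃-arrowDom e₀@(≃-mu {κ} {A} {B} n wA wB A# B# e) η S =
  arrowDom-μ wA wB A# A# B# B# (λ _ w → proj₂ (≃-fits e₀ η w))
    (λ S' → proj₁ (≃-arrowDom e (Bind η V (Fits η (μ κ A)) V (Fits η (μ κ B))) S')) ,
  arrowDom-μ wB wA B# B# A# A# (λ _ w → proj₁ (≃-fits e₀ η w))
    (λ S' → proj₂ (≃-arrowDom e (Bind η V (Fits η (μ κ B)) V (Fits η (μ κ A))) S'))
  where V = (κ , n)
≃-arrowDom (≃-idem _) η S = (λ { (ad-orL a) → a ; (ad-orR a) → a }) , ad-orL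
≃-arrowDom (≃-comm _) η S = (λ { (ad-orL a) → ad-orR a ; (ad-orR a) → ad-orL a }) ,
                            (λ { (ad-orL a) → ad-orR a ; (ad-orR a) → ad-orL a })
≃-arrowDom (≃-assoc _) η S =
  (λ { (ad-orL a) → ad-orL (ad-orL a) ; (ad-orR (ad-orL a)) → ad-orL (ad-orR a) ; (ad-orR (ad-orR a)) → ad-orR a }) ,
  (λ { (ad-orL (ad-orL a)) → ad-orL a ; (ad-orL (ad-orR a)) → ad-orR (ad-orL a) ; (ad-orR a) → ad-orR (ad-orR a) })
≃-arrowDom (≃-unfold _) η S = (λ { (ad-mu d) → d }) , ad-mu
≃-arrowDom e₀@(≃-fold {κ} {A} {B} wA wB e) η S =
  (λ d → ad-mu (unfold-agree (wf-closed wA) B.closed (λ w → proj₂ (≃-fits e₀ η w)) (proj₁ (≃-arrowDom e η S) d))) ,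
  (λ { (ad-mu d) → proj₂ (≃-arrowDom e η S) (unfold-agree B.closed (wf-closed wA) (λ w → proj₁ (≃-fits e₀ η w)) d) })
  where
  module B = MuBody (mu-body wB)
  unfold-agree : ∀ {T₁ T₂} → ClosedAt 0 T₁ → ClosedAt 0 T₂ → (∀ w → Fits η T₂ w → Fits η T₁ w) →
    ArrowDom η (inst B T₁) S → ArrowDom η (inst B T₂) S
  unfold-agree {T₁} {T₂} c₁ c₂ incl d =
    ≡subst (λ Z → ArrowDom η Z S) (sym (inst-substB B T₂))
      (arrowDom-substB B (dcons c₁ c₂ incl dnil) (allFree-every (λ _ _ p → p) B)
         B.closed B.contractive (B.guarded , tt) (inst-substB B T₁) d)

-- Subtyping preserves ArrowDom (contravariantly in the domain, via ≼-fits).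
≼-arrowDom : ∀ {Σ A B} → Σ ⊢ A ≼ B → ∀ η → Respects Σ η → ∀ S → ArrowDom η A S → ArrowDom η B S
≼-arrowDom (≼-refl _) η h S d = d
≼-arrowDom (≼-hyp m) η h S ()
≼-arrowDom (≼-eq e) η h S d = proj₁ (≃-arrowDom e η S) d
≼-arrowDom (≼-trans s1 s2) η h S d = ≼-arrowDom s2 η h S (≼-arrowDom s1 η h S d)
≼-arrowDom (≼-app _ _ _ _) η h S ()
≼-arrowDom (≼-arr _ _ s1 _) η h S (ad-arr f) = ad-arr (λ w d → f w (≼-fits s1 η h w d))
≼-arrowDom (≼-orL s1 s2) η h S (ad-orL d) = ≼-arrowDom s1 η h S d
≼-arrowDom (≼-orL s1 s2) η h S (ad-orR d) = ≼-arrowDom s2 η h S d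
≼-arrowDom (≼-orR₁ _ s) η h S d = ad-orL (≼-arrowDom s η h S d)
≼-arrowDom (≼-orR₂ _ s) η h S d = ad-orR (≼-arrowDom s η h S d)
≼-arrowDom s₀@(≼-mu {κ} {κ'} {A} {B} n m wA wB A# B# V∉ W∉ W#A V#B s) η h S d
  with (κ , n) ≟V (κ' , m)
... | no V≢W =
  arrowDom-μ wA wB A# (#-unopen 0 (fv (κ , n)) A W#A) (#-unopen 0 (fv (κ' , m)) B V#B) B#
    (λ V≡W → ⊥-elim (V≢W V≡W)) (λ S' → ≼-arrowDom s _ (respects-bind V∉ W∉ h (λ _ → to-W)) S') d
  where
  Qa = Fits η (μ κ A)
  Qb = Fits η (μ κ' B)
  to-W : ∀ {w} → Bind η (κ , n) Qa (κ' , m) Qb (κ , n) w → Bind η (κ , n) Qa (κ' , m) Qb (κ' , m) w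
  to-W (at-V q) = at-W (≼-fits s₀ η h _ q)
  to-W (at-W q) = at-W q
  to-W (elsewhere V≢V _ _) = ⊥-elim (V≢V refl)
-- With equal binder names the side conditions say that neither body mentions
-- its binder, so both μ's unfold to their (binder-free) bodies.
≼-arrowDom (≼-mu {κ} {.κ} {A} {B} n .n _ _ _ _ _ _ W#A V#B s) η h S (ad-mu d) | yes refl =
  ad-mu (≡subst (λ Z → ArrowDom η Z S) (open-vacuous 0 (fv (κ , n)) (μ κ B) B V#B)
    (≼-arrowDom s η (λ { (here refl) w p → p ; (there mem) → h mem }) S
      (≡subst (λ Z → ArrowDom η Z S) (open-vacuous 0 (μ κ A) (fv (κ , n)) A W#A) d)))

η∅ : Env
η∅ _ _ = ⊥

respects-[] : Respects [] η∅
respects-[] ()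

mutual
  data ClosedValue : Term → Set where
    cv-abs  : ∀ alts → ClosedValue (abs alts)
    cv-data : ∀ {t} → ClosedData t → ClosedValue t

  data ClosedData : Term → Set where
    cd-con : ∀ c → ClosedData (con c)
    cd-app : ∀ {t v} → ClosedData t → ClosedValue v → ClosedData (t · v)

closedData-isData : ∀ {t} → ClosedData t → isData t ≡ true
closedData-isData (cd-con c) = refl
closedData-isData (cd-app cd _) = closedData-isData cd

mutual
  closedHead : ∀ {t A} → [] ⊢ t ∶ A → Head t → ClosedData t
  closedHead (t-var ()) _
  closedHead t-con _ = cd-con _
  closedHead (t-data _ dr du) (h-app h v) = cd-app (closedHead dr h) (closedValue du v)
  closedHead (t-app dr _ _ du) (h-app h v) = cd-app (closedHead dr h) (closedValue du v)
  closedHead (t-sub d _ _) h = closedHead d h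

  closedValue : ∀ {t A} → [] ⊢ t ∶ A → Value t → ClosedValue t
  closedValue d (val-head h) = cv-data (closedHead d h)
  closedValue d (val-abs a) = cv-abs a

-- Typing is sound for Fits on closed values.  A head application typed by
-- the elimination rule would give its head an arrow type, which only
-- abstractions fit.
value-fits : ∀ {u A} → [] ⊢ u ∶ A → Value u → Fits η∅ A u
value-fits (t-var ()) _
value-fits t-con _ = f-cst
value-fits (t-data _ dr du) (val-head (h-app h v)) = f-app (value-fits dr (val-head h)) (value-fits du v)
value-fits (t-abs _ _ _) _ = f-arr
value-fits (t-app dr _ _ _) (val-head (h-app h _)) = ⊥-elim (head-not-arrow h (value-fits dr (val-head h)))
  where
  head-not-arrow : ∀ {T B r} → Head r → ¬ Fits η∅ (T ⊃ B) r
  head-not-arrow () f-arr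
value-fits (t-sub d _ le) v = ≼-fits le η∅ respects-[] _ (value-fits d v)

NoArrow : Ty → Set
NoArrow (fv _) = ⊤
NoArrow (bv _) = ⊤
NoArrow (cst _) = ⊤
NoArrow (_ ＠ _) = ⊤
NoArrow (_ ⊃ _) = ⊥
NoArrow (A ⊕ B) = NoArrow A × NoArrow B
NoArrow (μ _ A) = NoArrow A

noArrow-open : ∀ k U A → NoArrow A → NoArrow U → NoArrow (openT k U A)
noArrow-open k U (fv _) a b = tt
noArrow-open k U (bv j) a b with j ≡ᵇ k
... | true = b
... | false = tt
noArrow-open k U (cst _) a b = tt
noArrow-open k U (_ ＠ _) a b = tt
noArrow-open k U (A ⊕ B) (a1 , a2) b = noArrow-open k U A a1 b , noArrow-open k U B a2 b
noArrow-open k U (μ _ A) a b = noArrow-open (suc k) U A a b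

datatype-noArrow : ∀ {Δ D} → DT Δ D → NoArrow D
datatype-noArrow (dfv n) = tt
datatype-noArrow (dbv _) = tt
datatype-noArrow (dcst c) = tt
datatype-noArrow (dapp _ _) = tt
datatype-noArrow (dor d e) = datatype-noArrow d , datatype-noArrow e
datatype-noArrow (dmu d _) = datatype-noArrow d

noArrow-abs : ∀ {T alts} → NoArrow T → ¬ Fits η∅ T (abs alts)
noArrow-abs na (f-var ())
noArrow-abs () f-arr
noArrow-abs (n1 , _) (f-orL d) = noArrow-abs n1 d
noArrow-abs (_ , n2) (f-orR d) = noArrow-abs n2 d
noArrow-abs na (f-mu {κ} {A} d) = noArrow-abs (noArrow-open 0 (μ κ A) A na na) d

abs-arrowDom : ∀ {alts C} → [] ⊢ abs alts ∶ C →
  Σ (List Ty) λ As → Σ Ty λ T → Σ Ty λ B →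
    AltsTyped [] B alts As × Union As T × ArrowDom η∅ C (Fits η∅ T)
abs-arrowDom (t-abs at _ un) = _ , _ , _ , at , un , ad-arr (λ _ d → d)
abs-arrowDom (t-sub d _ le) with abs-arrowDom d
... | As , T , B , at , un , ad = As , T , B , at , un , ≼-arrowDom le η∅ respects-[] _ ad

fits-union : ∀ {As T A u} → Union As T → A ∈ As → Fits η∅ A u → Fits η∅ T u
fits-union leaf (here refl) d = d
fits-union (node {As = As} u1 u2) m d with ∈-++⁻ As m
... | inj₁ m' = f-orL (fits-union u1 m' d)
... | inj₂ m' = f-orR (fits-union u2 m' d)

fits-union⁻ : ∀ {As T u} → Union As T → Fits η∅ T u → ∃ λ A → A ∈ As × Fits η∅ A u
fits-union⁻ leaf d = _ , here refl , d
fits-union⁻ (node u1 u2) (f-orL d) with fits-union⁻ u1 d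
... | A , m , d' = A , ∈-++⁺ˡ m , d'
fits-union⁻ (node {As = As} u1 u2) (f-orR d) with fits-union⁻ u2 d
... | A , m , d' = A , ∈-++⁺ʳ As m , d'

match-decided : ∀ {u} → ClosedValue u → (p : Pat) → (∃ λ σ → match p u ≡ ok σ) ⊎ (match p u ≡ fail)
match-decided c (pv x) = inj₁ (_ , refl)
match-decided (cv-abs a) (pc c) = inj₂ refl
match-decided (cv-abs a) (p ∙ q) = inj₂ refl
match-decided (cv-data (cd-con c')) (pc c) with c ≡ᵇ c'
... | true = inj₁ (_ , refl)
... | false = inj₂ refl
match-decided (cv-data (cd-con c')) (p ∙ q) = inj₂ refl
match-decided (cv-data (cd-app cd cv)) (pc c) rewrite closedData-isData cd = inj₂ refl
match-decided (cv-data (cd-app cd cv)) (p ∙ q) rewrite closedData-isData cd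
  with match-decided (cv-data cd) p | match-decided cv q
... | inj₁ (_ , e1) | inj₁ (_ , e2) rewrite e1 | e2 = inj₁ (_ , refl)
... | inj₂ e1 | _ rewrite e1 = inj₂ refl
... | inj₁ (_ , e1) | inj₂ e2 rewrite e1 | e2 = inj₂ refl

match-fits : ∀ {θ p A u} → θ ⊢p p ∶ A → Fits η∅ A u → ClosedValue u → ∃ λ σ → match p u ≡ ok σ
match-fits (pt-var _) _ _ = _ , refl
match-fits (pt-con {c}) f-cst _ rewrite ≡ᵇ-refl c = _ , refl
match-fits (pt-app _ dp dq) (f-app dr dv) (cv-data (cd-app cd cv)) rewrite closedData-isData cd
  with match-fits dp dr (cv-data cd) | match-fits dq dv cv
... | (_ , e1) | (_ , e2) rewrite e1 | e2 = _ , refl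

fail≢ok : ∀ {σ} → fail ≢ ok σ
fail≢ok ()

-- If a closed value fits one of the pattern types, some alternative is
-- selected: the earlier ones fail, the first non-failing one matches.
select-exists : ∀ {Γ B alts As A u} → AltsTyped Γ B alts As → A ∈ As → Fits η∅ A u → ClosedValue u →
  ∃ λ t → Select alts u t
select-exists {alts = (p , θ , s) ∷ _} ((_ , _ , pt , _ , _) ∷ at) mem fits cv with match-decided cv p
... | inj₁ (_ , e) = _ , sel-here e
... | inj₂ e with mem
...   | here refl = ⊥-elim (fail≢ok (trans (sym e) (proj₂ (match-fits pt fits cv))))
...   | there m = let t , sel = select-exists at m fits cv in t , sel-there e sel

mutual
  head? : (t : Term) → Dec (Head t)
  head? (var x) = yes (h-var x)
  head? (con c) = yes (h-con c)
  head? (abs a) = no λ ()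
  head? (t · v) with head? t | value? v
  ... | yes h | yes w = yes (h-app h w)
  ... | no ¬h | _ = no λ { (h-app h _) → ¬h h }
  ... | yes _ | no ¬w = no λ { (h-app _ w) → ¬w w }

  value? : (t : Term) → Dec (Value t)
  value? (abs a) = yes (val-abs a)
  value? (var x) = yes (val-head (h-var x))
  value? (con c) = yes (val-head (h-con c))
  value? (t · v) with head? (t · v)
  ... | yes h = yes (val-head h)
  ... | no ¬h = no λ { (val-head h) → ¬h h }

Progress : Term → Set
Progress s = ∃ λ s' → s ⟶ s'

progress-app : ∀ {r u} → (¬ Value r → Progress r) → (¬ Value u → Progress u) →
  (∀ {alts} → r ≡ abs alts → Value u → Progress (r · u)) → ¬ Value (r · u) → Progress (r · u)
progress-app {r} {u} pr pu redex ¬v with value? r | value? u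
... | no ¬vr | _ = let r' , st = pr ¬vr in r' · u , appL st
... | yes _ | no ¬vu = let u' , st = pu ¬vu in r · u' , appR st
... | yes (val-head h) | yes vu = ⊥-elim (¬v (val-head (h-app h vu)))
... | yes (val-abs _) | yes vu = redex refl vu

progress-redex : ∀ {alts u T B As A} → [] ⊢ abs alts ∶ T ⊃ B → Union As T → A ∈ As →
  [] ⊢ u ∶ A → Value u → Progress (abs alts · u)
progress-redex dr un mem du vu with abs-arrowDom dr
... | _ , _ , _ , at , un₀ , ad-arr dom with fits-union⁻ un₀ (dom _ (fits-union un mem (value-fits du vu)))
...   | _ , mem₀ , fits with select-exists at mem₀ fits (closedValue du vu)
...     | t , sel = t , β sel

-- Progress for closed typed terms, by induction on the typing derivation;
-- a data structure is never an abstraction since datatypes have no arrows.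
progress : ∀ {s A} → [] ⊢ s ∶ A → ¬ Value s → Progress s
progress (t-var ()) ¬v
progress t-con ¬v = ⊥-elim (¬v (val-head (h-con _)))
progress (t-abs _ _ _) ¬v = ⊥-elim (¬v (val-abs _))
progress (t-sub d _ _) ¬v = progress d ¬v
progress (t-data isD dr du) =
  progress-app (progress dr) (progress du)
    (λ { refl _ → ⊥-elim (noArrow-abs (datatype-noArrow isD) (value-fits dr (val-abs _))) })
progress (t-app dr un mem du) =
  progress-app (progress dr) (progress du) (λ { refl vu → progress-redex dr un mem du vu })

proposition4p3 : (s : Term) (A : Ty) → Wf A → [] ⊢ s ∶ A → ¬ Value s →
    ∃ λ s' → s ⟶ s'
proposition4p3 s A _ = progress
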